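{- Let $K$ be an odd integer. Then $\omega_K(2)=\omega_K(4)=1$, and $\omega_K(2^x)=2$ for every integer $x\ge3$.
   Context: For an integer $K$, the $K$-Fibonacci sequence is $F_{K,0}=0$, $F_{K,1}=1$, $F_{K,n}=KF_{K,n-1}+F_{K,n-2}$ for $n\ge2$. For an integer $m\ge 2$, $\pi_K(m)$ is the least positive period of $(F_{K,n}\bmod m)$ and $\omega_K(m)$ is the number of indices $0\le n<\pi_K(m)$ with $m\mid F_{K,n}$. -}

module Defs where

open import Data.Nat as ℕ using (ℕ; zero; suc; _<_; _≤_)
open import Data.Nat.Divisibility as ℕD using ()
open import Data.Integer as ℤ using (ℤ; +_; _*_; _+_; _-_)
open import Data.Integer.Divisibility as ℤD using ()
open import Data.List using (List; length; filter; upTo)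

F : ℤ → ℕ → ℤ
F K zero = + 0
F K (suc zero) = + 1
F K (suc (suc n)) = K * F K (suc n) + F K n

IsPeriod : ℤ → ℕ → ℕ → Set
IsPeriod K m p = 0 < p × (∀ n → (+ m) ℤD.∣ (F K (n ℕ.+ p) - F K n))
  where open import Data.Product using (_×_)

IsPisanoPeriod : ℤ → ℕ → ℕ → Set
IsPisanoPeriod K m p = IsPeriod K m p × (∀ q → IsPeriod K m q → p ≤ q)
  where open import Data.Product using (_×_)

zerosBelow : ℤ → ℕ → ℕ → ℕ
zerosBelow K m p = length (filter (λ n → m ℕD.∣? ℤ.∣ F K n ∣) (upTo p))

ω≡ : ℤ → ℕ → ℕ → Set
ω≡ K m w = Σ ℕ (λ p → IsPisanoPeriod K m p × zerosBelow K m p ≡ w)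
  where open import Data.Product using (Σ; _×_)
        open import Relation.Binary.PropositionalEquality using (_≡_)

-- For odd K, K * K ≡ 1 (mod 8), which gives F 3 = 2·odd, F 6 = 8·odd, F 7 = 1 + 4·odd and F 1, F 2,
-- F 4, F 5 odd; hence ω = 1 for the moduli 2 and 4, with periods 3 and 6.
-- For 2 ^ (3 + j), the doubling formulas F (2n) = F n (2 F (n + 1) - K F n) and
-- F (2n + 1) = F (n + 1)² + F n² carry F n = 2 ^ (3 + j)·odd, F (n + 1) = 1 + 2 ^ (2 + j)·odd over to
-- the same shape one power of 2 higher at 2n, starting from n = 6. As F (s + n) ≡ F (n + 1) F s modulo
-- 2 ^ (3 + j) with F (n + 1) odd, the zeros of F modulo 2 ^ (3 + j) below the period 2n are exactly
-- 0 and n, so ω = 2.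

module Submission where

open import Defs
open import Data.Nat using (ℕ; _≤_; _^_)
open import Data.Integer using (ℤ; +_)
open import Data.Integer.Divisibility using (_∣_)
open import Data.Product using (_×_)
open import Relation.Nullary using (¬_)

open import Agda.Builtin.FromNat using (Number; fromNat)
open import Data.Empty using (⊥-elim)
open import Data.Integer using (_+_; _*_; _-_)
import Data.Integer as ℤ
import Data.Integer.DivMod as ℤ
import Data.Integer.Literals as ℤ
import Data.Integer.Properties as ℤP
open import Data.Integer.Divisibility.Signed as Signed using (divides) renaming (_∣_ to _∣ₛ_)
open import Data.Integer.Tactic.RingSolver using (solve; solve-∀)
open import Data.List using ([]; _∷_; [_]; _++_; length; filter; upTo)
import Data.List.Properties as List
open import Data.Nat using (zero; suc; _<_; _∸_; z≤n; s≤s)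
import Data.Nat as ℕ
import Data.Nat.Divisibility as ℕ
import Data.Nat.Literals as ℕ
import Data.Nat.Properties as ℕP
open import Data.Product using (∃-syntax; _,_; proj₁; proj₂)
import Data.Product as Product
open import Data.Sum using (_⊎_; inj₁; inj₂; [_,_]′)
open import Data.Unit using (tt)
open import Function using (_∘_; id)
open import Relation.Binary.Definitions using (tri<; tri≈; tri>)
open import Relation.Binary.PropositionalEquality hiding ([_])
open import Relation.Nullary using (yes; no; contradiction)
open import Relation.Unary using (Decidable)

instance
  ℕ-number : Number ℕ
  ℕ-number = ℕ.number
  ℤ-number : Number ℤ
  ℤ-number = ℤ.number

Odd : ℤ → Set
Odd x = ∃[ k ] x ≡ 1 + 2 * k

parity : ∀ x → 2 ∣ₛ x ⊎ Odd x
parity x with x ℤ.%ℕ 2 | ℤ.n%ℕd<d x 2 | ℤ.a≡a%ℕn+[a/ℕn]*n x 2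
... | 0 | _ | eq = inj₁ (divides (x ℤ./ℕ 2) (trans eq (ℤP.+-identityˡ _)))
... | 1 | _ | eq = inj₂ (x ℤ./ℕ 2 , trans eq (cong (_+_ 1) (ℤP.*-comm (x ℤ./ℕ 2) 2)))
... | suc (suc _) | s≤s (s≤s ()) | _

odd⇒¬2∣ : ∀ {x} → Odd x → ¬ 2 ∣ₛ x
odd⇒¬2∣ (k , refl) 2∣x = 2∤1 (Signed.∣m+n∣n⇒∣m 2∣x (Signed.∣m⇒∣m*n k Signed.∣-refl))
  where
  2∤1 : ¬ 2 ∣ₛ 1
  2∤1 2∣1 with ℕ.∣⇒≤ (Signed.∣⇒∣ᵤ 2∣1)
  ... | s≤s ()

¬2∣⇒odd : ∀ {x} → ¬ 2 ∣ₛ x → Odd x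
¬2∣⇒odd {x} 2∤x = [ ⊥-elim ∘ 2∤x , id ]′ (parity x)

odd⇒2∣[x-1] : ∀ {x} → Odd x → 2 ∣ₛ x - 1
odd⇒2∣[x-1] (k , refl) = divides k (solve (k ∷ []))

odd-* : ∀ {x y} → Odd x → Odd y → Odd (x * y)
odd-* (a , refl) (b , refl) = a + b + 2 * a * b , solve (a ∷ b ∷ [])

odd-+-even : ∀ {x} → Odd x → ∀ y → Odd (x + 2 * y)
odd-+-even (a , refl) y = a + y , solve (a ∷ y ∷ [])

odd-square : ∀ {x} → Odd x → ∃[ t ] x * x ≡ 1 + 8 * t
odd-square (k , refl) with parity k
... | inj₁ (divides a refl) = a + 2 * a * a , square-4a+1 a
  where
  square-4a+1 : ∀ a → (1 + 2 * (a * 2)) * (1 + 2 * (a * 2)) ≡ 1 + 8 * (a + 2 * a * a)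
  square-4a+1 = solve-∀
... | inj₂ (a , refl) = 1 + 3 * a + 2 * a * a , square-4a+3 a
  where
  square-4a+3 : ∀ a → (1 + 2 * (1 + 2 * a)) * (1 + 2 * (1 + 2 * a)) ≡ 1 + 8 * (1 + 3 * a + 2 * a * a)
  square-4a+3 = solve-∀

2^-nonZero : ∀ k → ℤ.NonZero (2 ℤ.^ k)
2^-nonZero k = ℤ.≢-nonZero (λ 2^k≡0 → contradiction (ℤP.i^n≡0⇒i≡0 2 k 2^k≡0) λ ())

2^k∣2^[1+k] : ∀ k → 2 ℤ.^ k ∣ₛ 2 ℤ.^ suc k
2^k∣2^[1+k] k = divides 2 refl

pos-2^ : ∀ k → + (2 ^ k) ≡ 2 ℤ.^ k
pos-2^ zero = refl
pos-2^ (suc k) = trans (ℤP.pos-* 2 (2 ^ k)) (cong (2 *_) (pos-2^ k))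

¬2^[1+k]∣2^k*odd : ∀ k {u} → Odd u → ¬ 2 ℤ.^ suc k ∣ₛ 2 ℤ.^ k * u
¬2^[1+k]∣2^k*odd k {u} odd-u d =
  odd⇒¬2∣ odd-u (Signed.*-cancelˡ-∣ (2 ℤ.^ k) {{2^-nonZero k}}
    (subst (_∣ₛ 2 ℤ.^ k * u) (ℤP.*-comm 2 (2 ℤ.^ k)) d))

2∣odd*x⇒2∣x : ∀ {c x} → Odd c → 2 ∣ₛ c * x → 2 ∣ₛ x
2∣odd*x⇒2∣x {x = x} (a , refl) d =
  Signed.∣m+n∣n⇒∣m (subst (2 ∣ₛ_) (expand a x) d) (Signed.∣m⇒∣m*n (a * x) Signed.∣-refl)
  where
  expand : ∀ a x → (1 + 2 * a) * x ≡ x + 2 * (a * x)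
  expand = solve-∀

2^k∣odd*x⇒2^k∣x : ∀ k {c x} → Odd c → 2 ℤ.^ k ∣ₛ c * x → 2 ℤ.^ k ∣ₛ x
2^k∣odd*x⇒2^k∣x zero {x = x} _ _ = divides x (sym (ℤP.*-identityʳ x))
2^k∣odd*x⇒2^k∣x (suc k) {c} odd-c d
  with divides y refl ← 2^k∣odd*x⇒2^k∣x k odd-c (Signed.∣-trans (2^k∣2^[1+k] k) d) =
  Signed.*-monoˡ-∣ (2 ℤ.^ k) (2∣odd*x⇒2∣x odd-c 2∣c*y)
  where
  2∣c*y : 2 ∣ₛ c * y
  2∣c*y = Signed.*-cancelʳ-∣ (2 ℤ.^ k) {{2^-nonZero k}}
            (subst (2 ℤ.^ suc k ∣ₛ_) (sym (ℤP.*-assoc c y (2 ℤ.^ k))) d)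

Recurrent : ℤ → (ℕ → ℤ) → Set
Recurrent K G = ∀ n → G (suc (suc n)) ≡ K * G (suc n) + G n

module _ {K : ℤ} where

  F-recurrent : Recurrent K (F K)
  F-recurrent _ = refl

  recurrent-∣ : ∀ {d G} → Recurrent K G → d ∣ₛ G 0 → d ∣ₛ G 1 → ∀ n → d ∣ₛ G n
  recurrent-∣ rec d∣G₀ d∣G₁ zero = d∣G₀
  recurrent-∣ rec d∣G₀ d∣G₁ (suc zero) = d∣G₁
  recurrent-∣ {d} rec d∣G₀ d∣G₁ (suc (suc n)) =
    subst (d ∣ₛ_) (sym (rec n))
      (Signed.∣m∣n⇒∣m+n (Signed.∣n⇒∣m*n K (recurrent-∣ rec d∣G₀ d∣G₁ (suc n)))
                        (recurrent-∣ rec d∣G₀ d∣G₁ n))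

  recurrent-≡ : ∀ {G H} → Recurrent K G → Recurrent K H → G 0 ≡ H 0 → G 1 ≡ H 1 →
                ∀ n → G n ≡ H n
  recurrent-≡ recG recH eq₀ eq₁ zero = eq₀
  recurrent-≡ recG recH eq₀ eq₁ (suc zero) = eq₁
  recurrent-≡ recG recH eq₀ eq₁ (suc (suc n)) =
    trans (recG n)
      (trans (cong₂ (λ x y → K * x + y) (recurrent-≡ recG recH eq₀ eq₁ (suc n))
                                        (recurrent-≡ recG recH eq₀ eq₁ n))
             (sym (recH n)))

  recurrent-- : ∀ {G H} → Recurrent K G → Recurrent K H → Recurrent K (λ n → G n - H n)
  recurrent-- {G} {H} recG recH n =
    trans (cong₂ _-_ (recG n) (recH n)) (linear K (G (suc n)) (G n) (H (suc n)) (H n))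
    where
    linear : ∀ K a b c d → (K * a + b) - (K * c + d) ≡ K * (a - c) + (b - d)
    linear = solve-∀

  F-shift-difference-recurrent : ∀ p → Recurrent K (λ n → F K (n ℕ.+ p) - F K n)
  F-shift-difference-recurrent p = recurrent-- {G = λ n → F K (n ℕ.+ p)} (λ _ → refl) F-recurrent

  -- F (m - 1) is written F (m + 1) - K * F m, so that no negative index is needed.
  F-+ : ∀ m n → F K (m ℕ.+ n) ≡ F K (suc n) * F K m + F K n * (F K (suc m) - K * F K m)
  F-+ m n = recurrent-≡ {G = λ m → F K (m ℕ.+ n)} (λ _ → refl) combination-recurrent
              (sym (at-0 K a b)) (sym (at-1 K a b)) m
    where
    a = F K (suc n)
    b = F K n
    at-0 : ∀ K a b → a * 0 + b * (1 - K * 0) ≡ b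
    at-0 = solve-∀
    at-1 : ∀ K a b → a * 1 + b * ((K * 1 + 0) - K * 1) ≡ a
    at-1 = solve-∀
    step : ∀ K a b x y → a * (K * y + x) + b * ((K * (K * y + x) + y) - K * (K * y + x))
                         ≡ K * (a * y + b * ((K * y + x) - K * y)) + (a * x + b * (y - K * x))
    step = solve-∀
    combination-recurrent : Recurrent K (λ m → a * F K m + b * (F K (suc m) - K * F K m))
    combination-recurrent m = step K a b (F K m) (F K (suc m))

  F-double : ∀ n → F K (n ℕ.+ n) ≡ F K n * (2 * F K (suc n) - K * F K n)
  F-double n = trans (F-+ n n) (factor K (F K (suc n)) (F K n))
    where
    factor : ∀ K a x → a * x + x * (a - K * x) ≡ x * (2 * a - K * x)
    factor = solve-∀

  F-double-suc : ∀ n → F K (suc (n ℕ.+ n)) ≡ F K (suc n) * F K (suc n) + F K n * F K n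
  F-double-suc n = trans (F-+ (suc n) n) (cancel K (F K (suc n)) (F K n))
    where
    cancel : ∀ K a b → a * a + b * ((K * a + b) - K * a) ≡ a * a + b * b
    cancel = solve-∀

module _ {K : ℤ} {m : ℕ} where

  isPeriod : ∀ {p} → 0 < p → + m ∣ₛ F K p → + m ∣ₛ F K (suc p) - 1 → IsPeriod K m p
  isPeriod {p} 0<p m∣F[p] m∣F[1+p]-1 = 0<p , λ n →
    Signed.∣⇒∣ᵤ (recurrent-∣ {K} {G = λ n → F K (n ℕ.+ p) - F K n}
                             (F-shift-difference-recurrent {K} p)
                             m∣F[p]-F[0] m∣F[1+p]-1 n)
    where
    m∣F[p]-F[0] : + m ∣ₛ F K p - F K 0
    m∣F[p]-F[0] = subst (+ m ∣ₛ_) (sym (ℤP.+-identityʳ (F K p))) m∣F[p]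

  isPeriod⇒∣ : ∀ {p} → IsPeriod K m p → + m ∣ₛ F K p × + m ∣ₛ F K (suc p) - 1
  isPeriod⇒∣ {p} (_ , m∣shift) =
    subst (+ m ∣ₛ_) (ℤP.+-identityʳ (F K p)) (Signed.∣ᵤ⇒∣ (m∣shift 0)) ,
    Signed.∣ᵤ⇒∣ (m∣shift 1)

  isPisanoPeriod : ∀ {p} → 0 < p → + m ∣ₛ F K p → + m ∣ₛ F K (suc p) - 1 →
                   (∀ q → 0 < q → q < p → + m ∣ₛ F K q → ¬ + m ∣ₛ F K (suc q) - 1) →
                   IsPisanoPeriod K m p
  isPisanoPeriod 0<p m∣F[p] m∣F[1+p]-1 no-earlier-period =
    isPeriod 0<p m∣F[p] m∣F[1+p]-1 , minimal
    where
    minimal : ∀ q → IsPeriod K m q → _ ≤ q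
    minimal q period@(0<q , _) = ℕP.≮⇒≥ λ q<p →
      let m∣F[q] , m∣F[1+q]-1 = isPeriod⇒∣ period in no-earlier-period q 0<q q<p m∣F[q] m∣F[1+q]-1

module Count {P : ℕ → Set} (P? : Decidable P) where

  count : ℕ → ℕ
  count n = length (filter P? (upTo n))

  count-suc : ∀ n → count (suc n) ≡ count n ℕ.+ length (filter P? [ n ])
  count-suc n = begin
    length (filter P? (upTo (suc n)))              ≡⟨ cong (length ∘ filter P?) (List.upTo-∷ʳ n) ⟨
    length (filter P? (upTo n ++ [ n ]))           ≡⟨ cong length (List.filter-++ P? (upTo n) [ n ]) ⟩
    length (filter P? (upTo n) ++ filter P? [ n ]) ≡⟨ List.length-++ (filter P? (upTo n)) ⟩
    count n ℕ.+ length (filter P? [ n ])           ∎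
    where open ≡-Reasoning

  count-accept : ∀ {n} → P n → count (suc n) ≡ suc (count n)
  count-accept {n} Pn = trans (count-suc n)
    (trans (cong (λ xs → count n ℕ.+ length xs) (List.filter-accept P? Pn)) (ℕP.+-comm (count n) 1))

  count-skip : ∀ {a b} → a ≤ b → (∀ i → a ≤ i → i < b → ¬ P i) → count b ≡ count a
  count-skip {b = zero} z≤n _ = refl
  count-skip {a} {suc b} a≤1+b ¬P with ℕP.m≤n⇒m<n∨m≡n a≤1+b
  ... | inj₂ refl = refl
  ... | inj₁ (s≤s a≤b) = begin
    count (suc b)                        ≡⟨ count-suc b ⟩
    count b ℕ.+ length (filter P? [ b ]) ≡⟨ cong (λ xs → count b ℕ.+ length xs)
                                                 (List.filter-reject P? (¬P b a≤b ℕP.≤-refl)) ⟩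
    count b ℕ.+ 0                        ≡⟨ ℕP.+-identityʳ (count b) ⟩
    count b                              ≡⟨ count-skip a≤b (λ i a≤i → ¬P i a≤i ∘ ℕP.m<n⇒m<1+n) ⟩
    count a                              ∎
    where open ≡-Reasoning

  count≡1 : ∀ {p} → 0 < p → P 0 → (∀ i → 0 < i → i < p → ¬ P i) → count p ≡ 1
  count≡1 0<p P0 ¬P = trans (count-skip 0<p ¬P) (count-accept P0)

  count≡2 : ∀ {n p} → 0 < n → n < p → P 0 → P n → (∀ i → 0 < i → i < p → i ≢ n → ¬ P i) →
            count p ≡ 2
  count≡2 {n} {p} 0<n n<p P0 Pn ¬P = begin
    count p           ≡⟨ count-skip n<p (λ i n<i i<p → ¬P i (ℕP.<-trans 0<n n<i) i<p (ℕP.>⇒≢ n<i)) ⟩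
    count (suc n)     ≡⟨ count-accept Pn ⟩
    suc (count n)     ≡⟨ cong suc (count-skip 0<n λ i 0<i i<n →
                                     ¬P i 0<i (ℕP.<-trans i<n n<p) (ℕP.<⇒≢ i<n)) ⟩
    suc (count 1)     ≡⟨ cong suc (count-accept P0) ⟩
    2                 ∎
    where open ≡-Reasoning

module _ {K : ℤ} {m : ℕ} where

  open Count (λ n → m ℕ.∣? ℤ.∣ F K n ∣)

  ω≡1 : ∀ {p} → 0 < p → + m ∣ₛ F K p → + m ∣ₛ F K (suc p) - 1 →
        (∀ r → 0 < r → r < p → ¬ + m ∣ₛ F K r) → ω≡ K m 1
  ω≡1 {p} 0<p m∣F[p] m∣F[1+p]-1 no-zero =
    p , isPisanoPeriod 0<p m∣F[p] m∣F[1+p]-1 (λ q 0<q q<p m∣F[q] _ → no-zero q 0<q q<p m∣F[q])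
      , count≡1 0<p (m ℕ.∣0) (λ r 0<r r<p → no-zero r 0<r r<p ∘ Signed.∣ᵤ⇒∣)

  ω≡2 : ∀ {n p} → 0 < n → n < p → + m ∣ₛ F K p → + m ∣ₛ F K (suc p) - 1 →
        + m ∣ₛ F K n → ¬ + m ∣ₛ F K (suc n) - 1 →
        (∀ r → 0 < r → r < p → r ≢ n → ¬ + m ∣ₛ F K r) → ω≡ K m 2
  ω≡2 {n} {p} 0<n n<p m∣F[p] m∣F[1+p]-1 m∣F[n] m∤F[1+n]-1 only-zero =
    p , isPisanoPeriod (ℕP.<-trans 0<n n<p) m∣F[p] m∣F[1+p]-1 no-earlier-period
      , count≡2 0<n n<p (m ℕ.∣0) (Signed.∣⇒∣ᵤ m∣F[n])
                (λ r 0<r r<p r≢n → only-zero r 0<r r<p r≢n ∘ Signed.∣ᵤ⇒∣)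
    where
    no-earlier-period : ∀ q → 0 < q → q < p → + m ∣ₛ F K q → ¬ + m ∣ₛ F K (suc q) - 1
    no-earlier-period q 0<q q<p m∣F[q] with q ℕ.≟ n
    ... | yes refl = m∤F[1+n]-1
    ... | no q≢n = contradiction m∣F[q] (only-zero q 0<q q<p q≢n)

record Rank (K : ℤ) (j n : ℕ) : Set where
  field
    {u e} : ℤ
    odd-u : Odd u
    odd-e : Odd e
    F-rank : F K n ≡ 2 ℤ.^ (3 ℕ.+ j) * u
    F-rank+1 : F K (suc n) ≡ 1 + 2 ℤ.^ (2 ℕ.+ j) * e
    no-earlier-zero : ∀ r → 0 < r → r < n → ¬ 2 ℤ.^ (3 ℕ.+ j) ∣ₛ F K r

module _ {K : ℤ} {j n : ℕ} (R : Rank K j n) where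
  open Rank R

  rank-∣ : 2 ℤ.^ (3 ℕ.+ j) ∣ₛ F K n
  rank-∣ = divides u (trans F-rank (ℤP.*-comm (2 ℤ.^ (3 ℕ.+ j)) u))

  F-rank+1-1 : F K (suc n) - 1 ≡ 2 ℤ.^ (2 ℕ.+ j) * e
  F-rank+1-1 = trans (cong (_- 1) F-rank+1) (cancel-1 (2 ℤ.^ (2 ℕ.+ j) * e))
    where
    cancel-1 : ∀ x → (1 + x) - 1 ≡ x
    cancel-1 = solve-∀

  rank-∣-next : 2 ℤ.^ (2 ℕ.+ j) ∣ₛ F K (suc n) - 1
  rank-∣-next = divides e (trans F-rank+1-1 (ℤP.*-comm (2 ℤ.^ (2 ℕ.+ j)) e))

  rank-∤-next : ¬ 2 ℤ.^ (3 ℕ.+ j) ∣ₛ F K (suc n) - 1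
  rank-∤-next = ¬2^[1+k]∣2^k*odd (2 ℕ.+ j) odd-e ∘ subst (_ ∣ₛ_) F-rank+1-1

  odd-F[1+rank] : Odd (F K (suc n))
  odd-F[1+rank] = 2 ℤ.^ (1 ℕ.+ j) * e , trans F-rank+1 (cong (_+_ 1) (ℤP.*-assoc 2 (2 ℤ.^ (1 ℕ.+ j)) e))

rank-pos : ∀ {K j n} → Rank K j n → 0 < n
rank-pos {j = j} {n = zero} R =
  ⊥-elim (¬2^[1+k]∣2^k*odd (3 ℕ.+ j) odd-u (subst (_ ∣ₛ_) F-rank (divides 0 refl)))
  where open Rank R
rank-pos {n = suc _} _ = s≤s z≤n

∣F[s+n]⇒∣F[1+n]*F[s] : ∀ {K d} n s → d ∣ₛ F K n → d ∣ₛ F K (s ℕ.+ n) →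
                       d ∣ₛ F K (suc n) * F K s
∣F[s+n]⇒∣F[1+n]*F[s] {K} {d} n s d∣F[n] d∣F[s+n] =
  Signed.∣m+n∣n⇒∣m (subst (d ∣ₛ_) (F-+ s n) d∣F[s+n])
                   (Signed.∣m⇒∣m*n (F K (suc s) - K * F K s) d∣F[n])

rank-zeros : ∀ {K j n} → Rank K j n →
             ∀ r → 0 < r → r < n ℕ.+ n → r ≢ n → ¬ 2 ℤ.^ (3 ℕ.+ j) ∣ₛ F K r
rank-zeros {K} {j} {n} R r 0<r r<2n r≢n d with ℕP.<-cmp r n
... | tri< r<n _ _ = Rank.no-earlier-zero R r 0<r r<n d
... | tri≈ _ r≡n _ = r≢n r≡n
... | tri> _ _ n<r = Rank.no-earlier-zero R (r ∸ n) (ℕP.m<n⇒0<n∸m n<r) r∸n<n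
  (2^k∣odd*x⇒2^k∣x (3 ℕ.+ j) (odd-F[1+rank] R) (∣F[s+n]⇒∣F[1+n]*F[s] n (r ∸ n) (rank-∣ R) d′))
  where
  r∸n<n : r ∸ n < n
  r∸n<n = ℕP.m<n+o⇒m∸n<o r n {{ℕ.>-nonZero (rank-pos R)}} r<2n
  d′ : 2 ℤ.^ (3 ℕ.+ j) ∣ₛ F K (r ∸ n ℕ.+ n)
  d′ = subst (λ i → 2 ℤ.^ (3 ℕ.+ j) ∣ₛ F K i) (sym (ℕP.m∸n+n≡m (ℕP.<⇒≤ n<r))) d

rank-double : ∀ {K j n} → Rank K j n → Rank K (suc j) (n ℕ.+ n)
rank-double {K} {j} {n} R = record
  { u = u′
  ; e = e′
  ; odd-u = odd-* odd-u (v , refl)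
  ; odd-e = odd-+-even odd-e w
  ; F-rank = F[2n]
  ; F-rank+1 = F[1+2n]
  ; no-earlier-zero = no-earlier-zero′
  }
  where
  open Rank R
  open ≡-Reasoning

  v w u′ e′ : ℤ
  v = 2 ℤ.^ (1 ℕ.+ j) * e - K * (2 ℤ.^ (1 ℕ.+ j) * u)
  w = 2 ℤ.^ j * (e * e) + 2 ℤ.^ (2 ℕ.+ j) * (u * u)
  u′ = u * (1 + 2 * v)
  e′ = e + 2 * w

  -- In the ring identities Q stands for 2 ^ j, so 2 ^ (3 + j) unfolds to 2 * (2 * (2 * Q)).
  F[2n] : F K (n ℕ.+ n) ≡ 2 ℤ.^ (4 ℕ.+ j) * u′
  F[2n] = begin
    F K (n ℕ.+ n)                          ≡⟨ F-double n ⟩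
    F K n * (2 * F K (suc n) - K * F K n)  ≡⟨ cong₂ (λ x y → x * (2 * y - K * x)) F-rank F-rank+1 ⟩
    2 ℤ.^ (3 ℕ.+ j) * u * (2 * (1 + 2 ℤ.^ (2 ℕ.+ j) * e) - K * (2 ℤ.^ (3 ℕ.+ j) * u))
                                           ≡⟨ identity K (2 ℤ.^ j) u e ⟩
    2 ℤ.^ (4 ℕ.+ j) * u′                   ∎
    where
    identity : ∀ K Q u e → 2 * (2 * (2 * Q)) * u * (2 * (1 + 2 * (2 * Q) * e) - K * (2 * (2 * (2 * Q)) * u))
                         ≡ 2 * (2 * (2 * (2 * Q))) * (u * (1 + 2 * (2 * Q * e - K * (2 * Q * u))))
    identity = solve-∀

  F[1+2n] : F K (suc (n ℕ.+ n)) ≡ 1 + 2 ℤ.^ (3 ℕ.+ j) * e′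
  F[1+2n] = begin
    F K (suc (n ℕ.+ n))                              ≡⟨ F-double-suc n ⟩
    F K (suc n) * F K (suc n) + F K n * F K n        ≡⟨ cong₂ (λ x y → y * y + x * x) F-rank F-rank+1 ⟩
    (1 + 2 ℤ.^ (2 ℕ.+ j) * e) * (1 + 2 ℤ.^ (2 ℕ.+ j) * e) + 2 ℤ.^ (3 ℕ.+ j) * u * (2 ℤ.^ (3 ℕ.+ j) * u)
                                                     ≡⟨ identity (2 ℤ.^ j) u e ⟩
    1 + 2 ℤ.^ (3 ℕ.+ j) * e′                         ∎
    where
    identity : ∀ Q u e → (1 + 2 * (2 * Q) * e) * (1 + 2 * (2 * Q) * e)
                         + 2 * (2 * (2 * Q)) * u * (2 * (2 * (2 * Q)) * u)
                       ≡ 1 + 2 * (2 * (2 * Q)) * (e + 2 * (Q * (e * e) + 2 * (2 * Q) * (u * u)))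
    identity = solve-∀

  no-earlier-zero′ : ∀ r → 0 < r → r < n ℕ.+ n → ¬ 2 ℤ.^ (4 ℕ.+ j) ∣ₛ F K r
  no-earlier-zero′ r 0<r r<2n d with r ℕ.≟ n
  ... | yes refl = ¬2^[1+k]∣2^k*odd (3 ℕ.+ j) odd-u (subst (_ ∣ₛ_) F-rank d)
  ... | no r≢n = rank-zeros R r 0<r r<2n r≢n (Signed.∣-trans (2^k∣2^[1+k] (3 ℕ.+ j)) d)

rank⇒ω : ∀ {K j n} → Rank K j n → ω≡ K (2 ^ (3 ℕ.+ j)) 2
rank⇒ω {K} {j} {n} R =
  ω≡2 (rank-pos R) (ℕP.m<m+n n (rank-pos R))
      (cast (Signed.∣-trans (2^k∣2^[1+k] (3 ℕ.+ j)) (rank-∣ R′))) (cast (rank-∣-next R′))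
      (cast (rank-∣ R)) (rank-∤-next R ∘ uncast)
      (λ r 0<r r<2n r≢n → rank-zeros R r 0<r r<2n r≢n ∘ uncast)
  where
  R′ = rank-double R
  cast : ∀ {x} → 2 ℤ.^ (3 ℕ.+ j) ∣ₛ x → + (2 ^ (3 ℕ.+ j)) ∣ₛ x
  cast = subst (_∣ₛ _) (sym (pos-2^ (3 ℕ.+ j)))
  uncast : ∀ {x} → + (2 ^ (3 ℕ.+ j)) ∣ₛ x → 2 ℤ.^ (3 ℕ.+ j) ∣ₛ x
  uncast = subst (_∣ₛ _) (pos-2^ (3 ℕ.+ j))

module OddK {K t : ℤ} (odd-K : Odd K) (K*K≡1+8t : K * K ≡ 1 + 8 * t) where
  open ≡-Reasoning

  K*[K*x] : ∀ x → K * (K * x) ≡ (1 + 8 * t) * x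
  K*[K*x] x = trans (sym (ℤP.*-assoc K K x)) (cong (_* x) K*K≡1+8t)

  F-2 : F K 2 ≡ K
  F-2 = trans (ℤP.+-identityʳ (K * 1)) (ℤP.*-identityʳ K)

  F-3 : F K 3 ≡ 2 * (1 + 2 * (2 * t))
  F-3 = begin
    K * F K 2 + 1         ≡⟨ cong (λ x → K * x + 1) F-2 ⟩
    K * K + 1             ≡⟨ cong (_+ 1) K*K≡1+8t ⟩
    1 + 8 * t + 1         ≡⟨ solve (t ∷ []) ⟩
    2 * (1 + 2 * (2 * t)) ∎

  F-4 : F K 4 ≡ K * (1 + 2 * (1 + 4 * t))
  F-4 = begin
    K * F K 3 + F K 2                  ≡⟨ cong₂ (λ a b → K * a + b) F-3 F-2 ⟩
    K * (2 * (1 + 2 * (2 * t))) + K    ≡⟨ solve (K ∷ t ∷ []) ⟩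
    K * (1 + 2 * (1 + 4 * t))          ∎

  F-5 : F K 5 ≡ 1 + 2 * (2 + 20 * t + 32 * (t * t))
  F-5 = begin
    K * F K 4 + F K 3                                   ≡⟨ cong₂ (λ a b → K * a + b) F-4 F-3 ⟩
    K * (K * (1 + 2 * (1 + 4 * t))) + 2 * (1 + 2 * (2 * t))
                                                        ≡⟨ cong (_+ 2 * (1 + 2 * (2 * t))) (K*[K*x] _) ⟩
    (1 + 8 * t) * (1 + 2 * (1 + 4 * t)) + 2 * (1 + 2 * (2 * t))
                                                        ≡⟨ solve (t ∷ []) ⟩
    1 + 2 * (2 + 20 * t + 32 * (t * t))                 ∎

  F-6 : F K 6 ≡ 8 * (K * (1 + 2 * (3 * t + 4 * (t * t))))
  F-6 = begin
    K * F K 5 + F K 4                                   ≡⟨ cong₂ (λ a b → K * a + b) F-5 F-4 ⟩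
    K * (1 + 2 * (2 + 20 * t + 32 * (t * t))) + K * (1 + 2 * (1 + 4 * t))
                                                        ≡⟨ solve (K ∷ t ∷ []) ⟩
    8 * (K * (1 + 2 * (3 * t + 4 * (t * t))))           ∎

  F-7 : F K 7 ≡ 1 + 4 * (1 + 2 * (1 + 19 * t + 64 * (t * t) + 64 * (t * (t * t))))
  F-7 = begin
    K * F K 6 + F K 5                                   ≡⟨ cong₂ (λ a b → K * a + b) F-6 F-5 ⟩
    K * (8 * (K * (1 + 2 * (3 * t + 4 * (t * t))))) + (1 + 2 * (2 + 20 * t + 32 * (t * t)))
                                                        ≡⟨ solve (K ∷ t ∷ []) ⟩
    8 * (K * (K * (1 + 2 * (3 * t + 4 * (t * t))))) + (1 + 2 * (2 + 20 * t + 32 * (t * t)))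
                                                        ≡⟨ cong (λ x → 8 * x + (1 + 2 * (2 + 20 * t + 32 * (t * t))))
                                                                (K*[K*x] _) ⟩
    8 * ((1 + 8 * t) * (1 + 2 * (3 * t + 4 * (t * t)))) + (1 + 2 * (2 + 20 * t + 32 * (t * t)))
                                                        ≡⟨ solve (t ∷ []) ⟩
    1 + 4 * (1 + 2 * (1 + 19 * t + 64 * (t * t) + 64 * (t * (t * t))))  ∎

  ¬4∣odd : ∀ {x} → Odd x → ¬ 4 ∣ₛ x
  ¬4∣odd odd-x = odd⇒¬2∣ odd-x ∘ Signed.∣-trans (divides 2 refl)

  odd-F[4] : Odd (F K 4)
  odd-F[4] = subst Odd (sym F-4) (odd-* odd-K (1 + 4 * t , refl))

  ¬4∣F : ∀ r → 0 < r → r < 6 → ¬ 4 ∣ₛ F K r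
  ¬4∣F 1 _ _ = ¬4∣odd (0 , refl)
  ¬4∣F 2 _ _ = ¬4∣odd (subst Odd (sym F-2) odd-K)
  ¬4∣F 3 _ _ = ¬2^[1+k]∣2^k*odd 1 (2 * t , refl) ∘ subst (4 ∣ₛ_) F-3
  ¬4∣F 4 _ _ = ¬4∣odd odd-F[4]
  ¬4∣F 5 _ _ = ¬4∣odd (2 + 20 * t + 32 * (t * t) , F-5)
  ¬4∣F (suc (suc (suc (suc (suc (suc _)))))) _ (s≤s (s≤s (s≤s (s≤s (s≤s (s≤s ()))))))

  rank-6 : Rank K 0 6
  rank-6 = record
    { odd-u = odd-* odd-K (3 * t + 4 * (t * t) , refl)
    ; odd-e = 1 + 19 * t + 64 * (t * t) + 64 * (t * (t * t)) , refl
    ; F-rank = F-6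
    ; F-rank+1 = F-7
    ; no-earlier-zero = λ r 0<r r<6 → ¬4∣F r 0<r r<6 ∘ Signed.∣-trans (divides 2 refl)
    }

  rank : ∀ j → ∃[ n ] Rank K j n
  rank zero = 6 , rank-6
  rank (suc j) = Product.map (λ n → n ℕ.+ n) rank-double (rank j)

  ω[2] : ω≡ K 2 1
  ω[2] = ω≡1 (s≤s z≤n) (divides (1 + 2 * (2 * t)) (trans F-3 (ℤP.*-comm 2 _)))
             (odd⇒2∣[x-1] odd-F[4]) ¬2∣F
    where
    ¬2∣F : ∀ r → 0 < r → r < 3 → ¬ 2 ∣ₛ F K r
    ¬2∣F 1 _ _ = odd⇒¬2∣ (0 , refl)
    ¬2∣F 2 _ _ = odd⇒¬2∣ (subst Odd (sym F-2) odd-K)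
    ¬2∣F (suc (suc (suc _))) _ (s≤s (s≤s (s≤s ())))

  ω[4] : ω≡ K 4 1
  ω[4] = ω≡1 (s≤s z≤n) (Signed.∣-trans (divides 2 refl) (rank-∣ rank-6)) (rank-∣-next rank-6) ¬4∣F

theorem4p25 : (K : ℤ) → ¬ ((+ 2) ∣ K) →
    ω≡ K 2 1 × ω≡ K 4 1 × ((x : ℕ) → 3 ≤ x → ω≡ K (2 ^ x) 2)
theorem4p25 K 2∤K = ω[2] , ω[4] , ω[2^x]
  where
  odd-K : Odd K
  odd-K = ¬2∣⇒odd (2∤K ∘ Signed.∣⇒∣ᵤ)
  K*K≡1+8t : ∃[ t ] K * K ≡ 1 + 8 * t
  K*K≡1+8t = odd-square odd-K
  open OddK {t = proj₁ K*K≡1+8t} odd-K (proj₂ K*K≡1+8t)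
  ω[2^x] : (x : ℕ) → 3 ≤ x → ω≡ K (2 ^ x) 2
  ω[2^x] (suc (suc (suc j))) (s≤s (s≤s (s≤s _))) = rank⇒ω (proj₂ (rank j))
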